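{- If $D$ is a strong digraph that is not semicomplete, then $\mathsf{d}_s^-(D)\le \kappa(UG(D))$.
   Context: Digraphs are finite, loopless, without parallel arcs. $D$ is strong if for every ordered pair $u,v$ there is a directed $uv$-walk. $D$ is semicomplete if for every two distinct vertices $u,v$ at least one of $(u,v),(v,u)$ is an arc. $UG(D)$ is the underlying simple graph ($uv$ an edge iff $(u,v)$ or $(v,u)$ is an arc), and $\kappa(G)$ is the minimum size of a vertex-cut of the connected graph $G$. $S\subseteq V(D)$ is in-dominating if every vertex not in $S$ has an out-neighbor in $S$; strong in-dominating if moreover $D\langle S\rangle$ is strong. $\mathsf{d}_s^-(D)$ is the maximum number of classes in a partition of $V(D)$ into strong in-dominating sets. -}

module Defs where

open import Data.Nat using (ℕ)
open import Data.Fin using (Fin)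
open import Data.Fin.Subset using (Subset; _∈_; _∉_)
open import Data.Product using (Σ; ∃; _×_; _,_)
open import Data.Sum using (_⊎_)
open import Relation.Nullary using (¬_)
open import Relation.Binary using (Decidable)
open import Relation.Binary.PropositionalEquality using (_≡_; _≢_)
open import Relation.Binary.Construct.Closure.ReflexiveTransitive using (Star)

record Digraph : Set₁ where
  field
    n        : ℕ
    Arc      : Fin n → Fin n → Set
    arc?     : Decidable Arc
    loopless : ∀ v → ¬ Arc v v
open Digraph public

Walk : (D : Digraph) → Fin (n D) → Fin (n D) → Set
Walk D = Star (Arc D)

Strong : Digraph → Set
Strong D = ∀ u v → Walk D u v

Semicomplete : Digraph → Set
Semicomplete D = ∀ u v → u ≢ v → Arc D u v ⊎ Arc D v u

UGEdge : (D : Digraph) → Fin (n D) → Fin (n D) → Set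
UGEdge D u v = Arc D u v ⊎ Arc D v u

IsVertexCut : (D : Digraph) → Subset (n D) → Set
IsVertexCut D X =
  Σ (Fin (n D)) λ u → Σ (Fin (n D)) λ v →
    u ∉ X × v ∉ X ×
    ¬ Star (λ x y → x ∉ X × y ∉ X × UGEdge D x y) u v

-- A partition of V(D) into k (nonempty) classes, given by a class map c;
-- class i is { v | c v ≡ i }.  Surjectivity = every class is nonempty.
IsPartition : (D : Digraph) (k : ℕ) → (Fin (n D) → Fin k) → Set
IsPartition D k c = ∀ i → ∃ λ v → c v ≡ i

InDominating : (D : Digraph) → (Fin (n D) → Set) → Set
InDominating D S = ∀ v → ¬ S v → ∃ λ w → S w × Arc D v w

InducedStrong : (D : Digraph) → (Fin (n D) → Set) → Set
InducedStrong D S = ∀ u v → S u → S v → Star (λ x y → S x × S y × Arc D x y) u v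

StrongInDominating : (D : Digraph) → (Fin (n D) → Set) → Set
StrongInDominating D S = InDominating D S × InducedStrong D S

StrongInDomPartition : (D : Digraph) (k : ℕ) → (Fin (n D) → Fin k) → Set
StrongInDomPartition D k c =
  IsPartition D k c × (∀ i → StrongInDominating D (λ v → c v ≡ i))

module Submission where

open import Defs
open import Data.Nat using (ℕ; _≤_)
open import Data.Fin using (Fin; zero; suc; _≟_)
open import Data.Fin.Properties using (any?; injective⇒≤; suc-injective)
open import Data.Fin.Subset using (Subset; ∣_∣; _∈_; _∉_)
open import Data.Fin.Subset.Properties using (_∈?_)
open import Data.Vec using (_∷_; here; there)
open import Data.Bool using (true; false)
open import Data.Product using (∃; _×_; _,_; proj₁; proj₂)
open import Data.Sum using (inj₁; inj₂)
open import Data.Empty using (⊥-elim)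
open import Function.Definitions using (Injective)
open import Relation.Nullary using (¬_; yes; no)
open import Relation.Nullary.Decidable using (_×-dec_)
open import Relation.Unary using (Decidable)
open import Relation.Binary.PropositionalEquality using (_≡_; refl; cong; sym; trans)
open import Relation.Binary.Construct.Closure.ReflexiveTransitive
  using (Star; ε; _◅_; _◅◅_; gmap; reverse)

-- Each strong in-dominating set S meets every vertex-cut X of UG(D): if S
-- avoided X, every vertex outside X would be joined in UG(D) − X to S (by an
-- arc into S), and S is connected there, so UG(D) − X would be connected.
-- The partition classes are disjoint, so choosing a vertex of X in each class
-- injects the k classes into X.

UGMinus : (D : Digraph) → Subset (n D) → Fin (n D) → Fin (n D) → Set
UGMinus D X x y = x ∉ X × y ∉ X × UGEdge D x y

UGMinus-sym : ∀ {D X x y} → UGMinus D X x y → UGMinus D X y x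
UGMinus-sym (x∉X , y∉X , inj₁ xy) = y∉X , x∉X , inj₂ xy
UGMinus-sym (x∉X , y∉X , inj₂ yx) = y∉X , x∉X , inj₁ yx

module _ (D : Digraph) (X : Subset (n D)) {S : Fin (n D) → Set}
         (S? : Decidable S) (S-sid : StrongInDominating D S)
         (S∩X≡∅ : ∀ {x} → S x → x ∉ X) where

  private
    Path : Fin (n D) → Fin (n D) → Set
    Path = Star (UGMinus D X)

  reaches-set : ∀ {u} → u ∉ X → ∃ λ a → S a × Path u a
  reaches-set {u} u∉X with S? u
  ... | yes Su = u , Su , ε
  ... | no ¬Su with proj₁ S-sid u ¬Su
  ...   | a , Sa , ua = a , Sa , (u∉X , S∩X≡∅ Sa , inj₁ ua) ◅ ε

  set-connected : ∀ {a b} → S a → S b → Path a b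
  set-connected Sa Sb = gmap (λ x → x)
    (λ { (Sx , Sy , xy) → S∩X≡∅ Sx , S∩X≡∅ Sy , inj₁ xy })
    (proj₂ S-sid _ _ Sa Sb)

  avoiding-strongInDominating⇒connected : ∀ {u v} → u ∉ X → v ∉ X → Path u v
  avoiding-strongInDominating⇒connected u∉X v∉X
    with reaches-set u∉X | reaches-set v∉X
  ... | a , Sa , u⇝a | b , Sb , v⇝b =
    u⇝a ◅◅ set-connected Sa Sb ◅◅ reverse (UGMinus-sym {D} {X}) v⇝b

strongInDominating-meets-cut : (D : Digraph) {S : Fin (n D) → Set} →
  Decidable S → StrongInDominating D S →
  (X : Subset (n D)) → IsVertexCut D X → ∃ λ x → x ∈ X × S x
strongInDominating-meets-cut D S? S-sid X (u , v , u∉X , v∉X , disconnected)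
  with any? (λ x → x ∈? X ×-dec S? x)
... | yes meets = meets
... | no avoids = ⊥-elim (disconnected
  (avoiding-strongInDominating⇒connected D X S? S-sid
    (λ {x} Sx x∈X → avoids (x , x∈X , Sx)) u∉X v∉X))

rank : ∀ {m} (X : Subset m) {x : Fin m} → x ∈ X → Fin ∣ X ∣
rank (true  ∷ X) here      = zero
rank (true  ∷ X) (there p) = suc (rank X p)
rank (false ∷ X) (there p) = rank X p

rank-injective : ∀ {m} (X : Subset m) {x y : Fin m} (p : x ∈ X) (q : y ∈ X) →
  rank X p ≡ rank X q → x ≡ y
rank-injective (true  ∷ X) here      here      _  = refl
rank-injective (true  ∷ X) (there p) (there q) eq =
  cong suc (rank-injective X p q (suc-injective eq))
rank-injective (false ∷ X) (there p) (there q) eq = cong suc (rank-injective X p q eq)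

injection-into-subset⇒≤ : ∀ {k m} (X : Subset m) (f : Fin k → Fin m) →
  Injective _≡_ _≡_ f → (∀ i → f i ∈ X) → k ≤ ∣ X ∣
injection-into-subset⇒≤ X f f-inj f∈X =
  injective⇒≤ {f = λ i → rank X (f∈X i)}
    (λ eq → f-inj (rank-injective X (f∈X _) (f∈X _) eq))

-- Strongness and non-semicompleteness only guarantee that κ(UG(D)) is defined;
-- the bound holds for every vertex-cut of any digraph.
proposition2 : (D : Digraph) → Strong D → ¬ Semicomplete D →
    (k : ℕ) (c : Fin (n D) → Fin k) → StrongInDomPartition D k c →
    (X : Subset (n D)) → IsVertexCut D X → k ≤ ∣ X ∣
proposition2 D _ _ k c (_ , classes-sid) X X-cut =
  injection-into-subset⇒≤ X (λ i → proj₁ (meet i)) section-injective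
    (λ i → proj₁ (proj₂ (meet i)))
  where
  meet : ∀ i → ∃ λ x → x ∈ X × c x ≡ i
  meet i = strongInDominating-meets-cut D (λ x → c x ≟ i) (classes-sid i) X X-cut

  section-injective : Injective _≡_ _≡_ (λ i → proj₁ (meet i))
  section-injective {i} {j} eq =
    trans (sym (proj₂ (proj₂ (meet i)))) (trans (cong c eq) (proj₂ (proj₂ (meet j))))
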